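{- Let $n\ge1$. There is a bijection $\varphi$ from the set $\mathcal{T}_n$ of plane trees with $n$ edges to the set $\mathcal{S}_n(132)$ of $132$-avoiding permutations of $\{1,\dots,n\}$ such that, for every $T\in\mathcal{T}_n$ with $\pi=\varphi(T)$: (1) the number of young leaves of $T$ equals the number of double descents of the permutation $(n+1)\pi=(n+1,\pi_1,\dots,\pi_n)$; (2) the number of old leaves of $T$ equals the number of ascending runs of the permutation $\pi(n+1)=(\pi_1,\dots,\pi_n,n+1)$.
   Context: A plane tree is a rooted tree with the children of each vertex linearly ordered left to right; a leaf is a vertex with no children; a leaf is old if it is the leftmost child of its parent, young otherwise. A permutation $\pi$ avoids $132$ if there are no indices $a<b<c$ with $\pi_a<\pi_c<\pi_b$. For a sequence $\sigma=\sigma_1\cdots\sigma_m$ of distinct numbers, a double descent is an index $i$ with $\sigma_i>\sigma_{i+1}>\sigma_{i+2}$, and an ascending run is a maximal increasing block of consecutive entries of length at least two, $\sigma_i<\sigma_{i+1}<\cdots<\sigma_{i+k}$ with $k\ge1$, not extendable to the left or right. -}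

module Defs where

open import Data.Nat using (ℕ; zero; suc; _+_; _<_; _<?_)
open import Data.Nat.Properties using ()
open import Data.Bool using (Bool; true; false; _∧_; not; if_then_else_)
open import Data.List using (List; []; _∷_; map; upTo; length; lookup)
open import Data.Fin using (Fin) renaming (_<_ to _<ᶠ_)
open import Data.Product using (_×_)
open import Relation.Nullary using (¬_; does)

data PTree : Set where
  node : List PTree → PTree

isLeaf : PTree → ℕ
isLeaf (node []) = 1
isLeaf (node (_ ∷ _)) = 0

mutual
  edges : PTree → ℕ
  edges (node cs) = edgesL cs

  edgesL : List PTree → ℕ
  edgesL [] = 0
  edgesL (t ∷ ts) = suc (edges t + edgesL ts)

mutual
  oldLeaves : PTree → ℕ
  oldLeaves (node []) = 0
  oldLeaves (node (c ∷ cs)) = isLeaf c + oldLeaves c + oldLeavesL cs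

  oldLeavesL : List PTree → ℕ
  oldLeavesL [] = 0
  oldLeavesL (t ∷ ts) = oldLeaves t + oldLeavesL ts

mutual
  youngLeaves : PTree → ℕ
  youngLeaves (node []) = 0
  youngLeaves (node (c ∷ cs)) = youngLeaves c + youngLeavesL cs

  -- cs are non-leftmost children
  youngLeavesL : List PTree → ℕ
  youngLeavesL [] = 0
  youngLeavesL (t ∷ ts) = isLeaf t + youngLeaves t + youngLeavesL ts

oneTo : ℕ → List ℕ
oneTo n = map suc (upTo n)

Avoids132 : List ℕ → Set
Avoids132 π = (a b c : Fin (length π)) → a <ᶠ b → b <ᶠ c →
  ¬ ((lookup π a < lookup π c) × (lookup π c < lookup π b))

doubleDescents : List ℕ → ℕ
doubleDescents (x ∷ y ∷ z ∷ r) =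
  (if does (y <? x) ∧ does (z <? y) then 1 else 0) + doubleDescents (y ∷ z ∷ r)
doubleDescents _ = 0

-- number of ascending runs (maximal increasing blocks of length ≥ 2) =
-- number of ascents σ_i < σ_{i+1} not preceded by an ascent σ_{i-1} < σ_i.
ascRunsFrom : Bool → List ℕ → ℕ
ascRunsFrom prev (x ∷ y ∷ r) =
  (if does (x <? y) ∧ not prev then 1 else 0) + ascRunsFrom (does (x <? y)) (y ∷ r)
ascRunsFrom _ _ = 0

ascendingRuns : List ℕ → ℕ
ascendingRuns = ascRunsFrom false

module Submission where

-- Give the edges of a forest t₁ t₂ ⋯ t_k the labels o+1, o+2, …: the edges below the root of t₁
-- get the smallest labels, the edge into t₁ the next one, m, and the edges of t₂ ⋯ t_k the labels
-- above m. The word of the forest is σ τ m, where τ is the word of the subforest below t₁ and σ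
-- that of t₂ ⋯ t_k. As σ > m > τ, these words avoid 132; conversely a 132-avoider ending in m
-- splits uniquely as σ τ m with σ > m > τ, which gives the bijection.
-- The step into m in σ τ m is a descent exactly when t₁ is a leaf, and the step out of the label
-- of a tree is an ascent exactly when the tree is its parent's first child. Hence the double
-- descents of (n+1)π sit at the labels of young leaves and the ascending runs of π(n+1) start at
-- the labels of old leaves.

open import Defs
open import Data.Nat using (ℕ; zero; suc; _+_; _≤_; _<_; _≥_; z≤n; s≤s; _<?_)
open import Data.Nat.Properties
open import Data.Nat.Induction using (<-wellFounded)
open import Data.Nat.Solver using (module +-*-Solver)
open import Data.Bool using (Bool; true; false; _∧_; not; if_then_else_)
open import Data.Bool.Properties using (∧-zeroʳ; ∧-identityʳ; not-involutive)
open import Data.Empty using (⊥; ⊥-elim)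
open import Data.Fin using (Fin; zero; suc; toℕ)
open import Data.Product using (Σ; ∃; ∃₂; _×_; _,_; proj₁; proj₂)
open import Data.List using (List; []; _∷_; _++_; [_]; null; filter; applyUpTo; length; lookup; initLast; _∷ʳ′_)
open import Data.List.Properties
  using ( ++-assoc; ++-identityʳ; ++-conicalʳ; map-applyUpTo; ∷ʳ-injective
        ; filter-++; filter-all; filter-none; filter-reject)
open import Data.List.Membership.Propositional using (_∈_; _∉_)
open import Data.List.Membership.Propositional.Properties using (∈-++⁺ʳ; ∈-lookup)
open import Data.List.Relation.Unary.Any using (here; there)
open import Data.List.Relation.Unary.All as All using (All; []; _∷_)
import Data.List.Relation.Unary.All.Properties as All
open import Data.List.Relation.Unary.AllPairs using ([]; _∷_)
open import Data.List.Relation.Unary.Unique.Propositional using (Unique)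
open import Data.List.Relation.Unary.Unique.Propositional.Properties using (Unique[x∷xs]⇒x∉xs)
open import Data.List.Relation.Binary.Sublist.Propositional {A = ℕ}
  using (_⊆_; []; _∷_; _∷ʳ_; minimum; from∈; ⊆-refl; ⊆-trans)
import Data.List.Relation.Binary.Sublist.Propositional.Properties as Sublist
open import Data.List.Relation.Binary.Permutation.Propositional
  using (_↭_; module PermutationReasoning; ↭-refl; ↭-sym; ↭-trans; ↭⇒↭ₛ)
import Data.List.Relation.Binary.Permutation.Propositional.Properties as Perm
open import Relation.Binary.PropositionalEquality.Properties using (setoid)
open import Data.List.Relation.Binary.Permutation.Setoid.Properties (setoid ℕ) using (Unique-resp-↭)
open import Function using (_∘_; id)
open import Induction.WellFounded using (Acc; acc)
open import Relation.Binary using (tri<; tri≈; tri>)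
open import Relation.Binary.PropositionalEquality
  using (_≡_; _≢_; refl; sym; trans; cong; cong₂; subst; subst₂; module ≡-Reasoning)
open import Relation.Nullary using (¬_; does)
open import Relation.Nullary.Decidable using (dec-true; dec-false)

open +-*-Solver using (solve; _:=_; _:+_; con)

-- Intervals of labels

interval : ℕ → ℕ → List ℕ
interval o zero    = []
interval o (suc n) = suc o ∷ interval (suc o) n

applyUpTo-interval : ∀ (f : ℕ → ℕ) o n → (∀ i → f i ≡ suc (o + i)) → applyUpTo f n ≡ interval o n
applyUpTo-interval f o zero    f≗ = refl
applyUpTo-interval f o (suc n) f≗ =
  cong₂ _∷_ (trans (f≗ 0) (cong suc (+-identityʳ o)))
            (applyUpTo-interval (f ∘ suc) (suc o) n (λ i → trans (f≗ (suc i)) (cong suc (+-suc o i))))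

oneTo≡interval : ∀ n → oneTo n ≡ interval 0 n
oneTo≡interval n = trans (map-applyUpTo id suc n) (applyUpTo-interval suc 0 n (λ _ → refl))

interval-++ : ∀ o a b → interval o (a + b) ≡ interval o a ++ interval (o + a) b
interval-++ o zero    b = cong (λ o′ → interval o′ b) (sym (+-identityʳ o))
interval-++ o (suc a) b = cong (suc o ∷_) (trans (interval-++ (suc o) a b)
  (cong (λ o′ → interval (suc o) a ++ interval o′ b) (sym (+-suc o a))))

∈-interval⁻ : ∀ {v} o n → v ∈ interval o n → o < v × v ≤ o + n
∈-interval⁻ o (suc n) (here refl) = n<1+n o , ≤-trans (s≤s (m≤m+n o n)) (≤-reflexive (sym (+-suc o n)))
∈-interval⁻ o (suc n) (there v∈) with o<v , v≤ ← ∈-interval⁻ (suc o) n v∈ =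
  <-trans (n<1+n o) o<v , ≤-trans v≤ (≤-reflexive (sym (+-suc o n)))

∈-interval⇒split : ∀ {v} o n → v ∈ interval o n → ∃₂ λ a b → n ≡ suc (a + b) × v ≡ suc (o + a)
∈-interval⇒split o (suc n) (here refl) = 0 , n , refl , cong suc (sym (+-identityʳ o))
∈-interval⇒split o (suc n) (there v∈) with a , b , refl , refl ← ∈-interval⇒split (suc o) n v∈ =
  suc a , b , refl , cong suc (sym (+-suc o a))

interval-unique : ∀ o n → Unique (interval o n)
interval-unique o zero    = []
interval-unique o (suc n) =
  All.tabulate (λ v∈ → <⇒≢ (proj₁ (∈-interval⁻ (suc o) n v∈))) ∷ interval-unique (suc o) n

-- Words of the shape σ τ m with σ > m > τ

glue : List ℕ → List ℕ → ℕ → List ℕ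
glue high low m = high ++ low ++ [ m ]

Separated : ℕ → List ℕ → List ℕ → Set
Separated m high low = All (m <_) high × All (_< m) low

interval-separated : ∀ o a b → Separated (suc (o + a)) (interval (suc (o + a)) b) (interval o a)
interval-separated o a b =
  All.tabulate (proj₁ ∘ ∈-interval⁻ _ b) , All.tabulate (s≤s ∘ proj₂ ∘ ∈-interval⁻ o a)

interval↭glue : ∀ o a b →
  interval o (suc (a + b)) ↭ glue (interval (suc (o + a)) b) (interval o a) (suc (o + a))
interval↭glue o a b = begin
  interval o (suc (a + b))   ≡⟨ cong (interval o) (sym (+-suc a b)) ⟩
  interval o (a + suc b)     ≡⟨ interval-++ o a (suc b) ⟩
  low ++ m ∷ high            ≡⟨ sym (++-assoc low [ m ] high) ⟩
  (low ++ [ m ]) ++ high     ↭⟨ Perm.++-comm (low ++ [ m ]) high ⟩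
  high ++ low ++ [ m ]       ∎
  where
  open PermutationReasoning
  m : ℕ
  m = suc (o + a)
  low high : List ℕ
  low = interval o a
  high = interval m b

glue-↭⁺ : ∀ {m S S′ A A′} → S ↭ S′ → A ↭ A′ → glue S A m ↭ glue S′ A′ m
glue-↭⁺ {m} S↭ A↭ = Perm.++⁺ S↭ (Perm.++⁺ʳ [ m ] A↭)

filter-glue-low : ∀ {m S A} → Separated m S A → filter (_<? m) (glue S A m) ≡ A
filter-glue-low {m} {S} {A} (S>m , A<m) = begin
  filter (_<? m) (S ++ A ++ [ m ])
    ≡⟨ filter-++ (_<? m) S (A ++ [ m ]) ⟩
  filter (_<? m) S ++ filter (_<? m) (A ++ [ m ])
    ≡⟨ cong₂ _++_ (filter-none (_<? m) (All.map <⇒≯ S>m)) (filter-++ (_<? m) A [ m ]) ⟩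
  filter (_<? m) A ++ filter (_<? m) [ m ]
    ≡⟨ cong₂ _++_ (filter-all (_<? m) A<m) (filter-reject (_<? m) (n≮n m)) ⟩
  A ++ []
    ≡⟨ ++-identityʳ A ⟩
  A ∎
  where open ≡-Reasoning

filter-glue-high : ∀ {m S A} → Separated m S A → filter (m <?_) (glue S A m) ≡ S
filter-glue-high {m} {S} {A} (S>m , A<m) = begin
  filter (m <?_) (S ++ A ++ [ m ])
    ≡⟨ filter-++ (m <?_) S (A ++ [ m ]) ⟩
  filter (m <?_) S ++ filter (m <?_) (A ++ [ m ])
    ≡⟨ cong₂ _++_ (filter-all (m <?_) S>m) (filter-++ (m <?_) A [ m ]) ⟩
  S ++ filter (m <?_) A ++ filter (m <?_) [ m ]
    ≡⟨ cong (λ rest → S ++ rest ++ _) (filter-none (m <?_) (All.map <⇒≯ A<m)) ⟩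
  S ++ filter (m <?_) [ m ]
    ≡⟨ cong (S ++_) (filter-reject (m <?_) (n≮n m)) ⟩
  S ++ []
    ≡⟨ ++-identityʳ S ⟩
  S ∎
  where open ≡-Reasoning

glue-↭⁻ : ∀ {m S S′ A A′} → Separated m S A → Separated m S′ A′ →
  glue S A m ↭ glue S′ A′ m → S ↭ S′ × A ↭ A′
glue-↭⁻ {m} sep sep′ p =
  subst₂ _↭_ (filter-glue-high sep) (filter-glue-high sep′) (Perm.filter-↭ (m <?_) p) ,
  subst₂ _↭_ (filter-glue-low sep) (filter-glue-low sep′) (Perm.filter-↭ (_<? m) p)

glue-injective : ∀ {m m′ S S′ A A′} → Separated m S A → Separated m′ S′ A′ →
  glue S A m ≡ glue S′ A′ m′ → m ≡ m′ × S ≡ S′ × A ≡ A′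
glue-injective {m} {m′} {S} {S′} {A} {A′} sep sep′ eq
  with refl ← proj₂ (∷ʳ-injective (S ++ A) (S′ ++ A′)
                      (trans (++-assoc S A [ m ]) (trans eq (sym (++-assoc S′ A′ [ m′ ])))))
  = refl ,
    trans (sym (filter-glue-high sep)) (trans (cong (filter (m <?_)) eq) (filter-glue-high sep′)) ,
    trans (sym (filter-glue-low sep)) (trans (cong (filter (_<? m)) eq) (filter-glue-low sep′))

glue≢[] : ∀ S A m → glue S A m ≢ []
glue≢[] S A m eq with () ← ++-conicalʳ A [ m ] (++-conicalʳ S (A ++ [ m ]) eq)

-- Pattern avoidance through subsequences

Avoids132ˢ : List ℕ → Set
Avoids132ˢ π = ∀ {a b c} → a ∷ b ∷ c ∷ [] ⊆ π → ¬ (a < c × c < b)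

lookup²-⊆ : ∀ π (i j : Fin (length π)) → toℕ i < toℕ j → lookup π i ∷ lookup π j ∷ [] ⊆ π
lookup²-⊆ (x ∷ π) zero    (suc j) _         = refl ∷ from∈ (∈-lookup j)
lookup²-⊆ (x ∷ π) (suc i) (suc j) (s≤s i<j) = x ∷ʳ lookup²-⊆ π i j i<j

lookup³-⊆ : ∀ π (i j k : Fin (length π)) → toℕ i < toℕ j → toℕ j < toℕ k →
  lookup π i ∷ lookup π j ∷ lookup π k ∷ [] ⊆ π
lookup³-⊆ (x ∷ π) zero    (suc j) (suc k) _         (s≤s j<k) = refl ∷ lookup²-⊆ π j k j<k
lookup³-⊆ (x ∷ π) (suc i) (suc j) (suc k) (s≤s i<j) (s≤s j<k) = x ∷ʳ lookup³-⊆ π i j k i<j j<k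

⊆-lookup¹ : ∀ {a π} → [ a ] ⊆ π → ∃ λ (i : Fin (length π)) → lookup π i ≡ a
⊆-lookup¹ (_ ∷ʳ a⊆)  = let i , eq = ⊆-lookup¹ a⊆ in suc i , eq
⊆-lookup¹ (refl ∷ _) = zero , refl

⊆-lookup² : ∀ {a b π} → a ∷ b ∷ [] ⊆ π → ∃₂ λ (i j : Fin (length π)) →
  toℕ i < toℕ j × lookup π i ≡ a × lookup π j ≡ b
⊆-lookup² (_ ∷ʳ ab⊆)  =
  let i , j , i<j , eqa , eqb = ⊆-lookup² ab⊆ in suc i , suc j , s≤s i<j , eqa , eqb
⊆-lookup² (refl ∷ b⊆) =
  let j , eqb = ⊆-lookup¹ b⊆ in zero , suc j , s≤s z≤n , refl , eqb

⊆-lookup³ : ∀ {a b c π} → a ∷ b ∷ c ∷ [] ⊆ π →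
  ∃₂ λ (i j : Fin (length π)) → ∃ λ (k : Fin (length π)) → toℕ i < toℕ j × toℕ j < toℕ k × lookup π i ≡ a × lookup π j ≡ b × lookup π k ≡ c
⊆-lookup³ (_ ∷ʳ abc⊆)  =
  let i , j , k , i<j , j<k , eqs = ⊆-lookup³ abc⊆ in suc i , suc j , suc k , s≤s i<j , s≤s j<k , eqs
⊆-lookup³ (refl ∷ bc⊆) =
  let j , k , j<k , eqb , eqc = ⊆-lookup² bc⊆
  in zero , suc j , suc k , s≤s z≤n , s≤s j<k , refl , eqb , eqc

Avoids132ˢ⇒Avoids132 : ∀ π → Avoids132ˢ π → Avoids132 π
Avoids132ˢ⇒Avoids132 π avoids i j k i<j j<k = avoids (lookup³-⊆ π i j k i<j j<k)

Avoids132⇒Avoids132ˢ : ∀ π → Avoids132 π → Avoids132ˢ π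
Avoids132⇒Avoids132ˢ π avoids abc⊆ (a<c , c<b) =
  let i , j , k , i<j , j<k , eqa , eqb , eqc = ⊆-lookup³ abc⊆
  in avoids i j k i<j j<k (subst₂ _<_ (sym eqa) (sym eqc) a<c , subst₂ _<_ (sym eqc) (sym eqb) c<b)

avoids-⊆ : ∀ {xs ys} → xs ⊆ ys → Avoids132ˢ ys → Avoids132ˢ xs
avoids-⊆ xs⊆ys avoids abc⊆ = avoids (⊆-trans abc⊆ xs⊆ys)

⊆-++⁻ : ∀ {w} xs ys → w ⊆ xs ++ ys → ∃₂ λ w₁ w₂ → w ≡ w₁ ++ w₂ × w₁ ⊆ xs × w₂ ⊆ ys
⊆-++⁻ []       ys w⊆ = [] , _ , refl , minimum _ , w⊆
⊆-++⁻ (x ∷ xs) ys (_ ∷ʳ w⊆) with w₁ , w₂ , refl , w₁⊆ , w₂⊆ ← ⊆-++⁻ xs ys w⊆ =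
  w₁ , w₂ , refl , x ∷ʳ w₁⊆ , w₂⊆
⊆-++⁻ (x ∷ xs) ys (refl ∷ w⊆) with w₁ , w₂ , refl , w₁⊆ , w₂⊆ ← ⊆-++⁻ xs ys w⊆ =
  x ∷ w₁ , w₂ , refl , refl ∷ w₁⊆ , w₂⊆

avoids-++ : ∀ {m xs ys} → All (m <_) xs → All (_≤ m) ys →
  Avoids132ˢ xs → Avoids132ˢ ys → Avoids132ˢ (xs ++ ys)
avoids-++ {m} {xs} {ys} xs>m ys≤m avoids-xs avoids-ys {a} {b} {c} abc⊆ (a<c , c<b)
  with w₁ , w₂ , eq , w₁⊆ , w₂⊆ ← ⊆-++⁻ xs ys abc⊆ = by-split w₁ w₂ eq w₁⊆ w₂⊆
  where
  crossing : m < a → c ≤ m → ⊥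
  crossing m<a c≤m = <-irrefl refl (<-trans a<c (≤-<-trans c≤m m<a))
  by-split : ∀ w₁ w₂ → a ∷ b ∷ c ∷ [] ≡ w₁ ++ w₂ → w₁ ⊆ xs → w₂ ⊆ ys → ⊥
  by-split []                  _ refl _   w₂⊆ = avoids-ys w₂⊆ (a<c , c<b)
  by-split (_ ∷ [])            _ refl w₁⊆ w₂⊆
    with m<a ∷ [] ← Sublist.All-resp-⊆ w₁⊆ xs>m | _ ∷ c≤m ∷ [] ← Sublist.All-resp-⊆ w₂⊆ ys≤m =
    crossing m<a c≤m
  by-split (_ ∷ _ ∷ [])        _ refl w₁⊆ w₂⊆
    with m<a ∷ _ ← Sublist.All-resp-⊆ w₁⊆ xs>m | c≤m ∷ [] ← Sublist.All-resp-⊆ w₂⊆ ys≤m =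
    crossing m<a c≤m
  by-split (_ ∷ _ ∷ _ ∷ [])    _ refl w₁⊆ _   = avoids-xs w₁⊆ (a<c , c<b)
  by-split (_ ∷ _ ∷ _ ∷ _ ∷ _) _ ()

avoids-++-max : ∀ {m xs} → All (_< m) xs → Avoids132ˢ xs → Avoids132ˢ (xs ++ [ m ])
avoids-++-max {m} {xs} xs<m avoids-xs {a} {b} {c} abc⊆ (a<c , c<b)
  with w₁ , w₂ , eq , w₁⊆ , w₂⊆ ← ⊆-++⁻ xs [ m ] abc⊆ = by-split w₁ w₂ eq w₁⊆ w₂⊆
  where
  by-split : ∀ w₁ w₂ → a ∷ b ∷ c ∷ [] ≡ w₁ ++ w₂ → w₁ ⊆ xs → w₂ ⊆ [ m ] → ⊥
  by-split []                  _ refl _   (_ ∷ʳ ())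
  by-split []                  _ refl _   (refl ∷ ())
  by-split (_ ∷ [])            _ refl _   (_ ∷ʳ ())
  by-split (_ ∷ [])            _ refl _   (refl ∷ ())
  by-split (_ ∷ _ ∷ [])        _ refl w₁⊆ (refl ∷ [])
    with _ ∷ b<m ∷ [] ← Sublist.All-resp-⊆ w₁⊆ xs<m = <-irrefl refl (<-trans b<m c<b)
  by-split (_ ∷ _ ∷ _ ∷ [])    _ refl w₁⊆ _   = avoids-xs w₁⊆ (a<c , c<b)
  by-split (_ ∷ _ ∷ _ ∷ _ ∷ _) _ ()

glue-avoids : ∀ {m S A} → Separated m S A → Avoids132ˢ S → Avoids132ˢ A → Avoids132ˢ (glue S A m)
glue-avoids (S>m , A<m) avoids-S avoids-A =
  avoids-++ S>m (All.++⁺ (All.map <⇒≤ A<m) (≤-refl ∷ [])) avoids-S (avoids-++-max A<m avoids-A)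

low∷glue-avoids⇒high≡[] : ∀ {x m} S A → x < m → All (m <_) S →
  Avoids132ˢ (x ∷ glue S A m) → S ≡ []
low∷glue-avoids⇒high≡[] []      A x<m _         _      = refl
low∷glue-avoids⇒high≡[] (s ∷ S) A x<m (m<s ∷ _) avoids =
  ⊥-elim (avoids (refl ∷ refl ∷ Sublist.++⁺ˡ S (Sublist.++⁺ˡ A ⊆-refl)) (x<m , m<s))

avoids-++-last⇒glue : ∀ m Q → Avoids132ˢ (Q ++ [ m ]) → m ∉ Q →
  ∃₂ λ S A → Q ++ [ m ] ≡ glue S A m × Separated m S A
avoids-++-last⇒glue m []      _      _  = [] , [] , refl , [] , []
avoids-++-last⇒glue m (x ∷ Q) avoids m∉
  with S , A , eq , S>m , A<m ← avoids-++-last⇒glue m Q (avoids-⊆ (x ∷ʳ ⊆-refl) avoids) (m∉ ∘ there)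
  with <-cmp x m
... | tri> _ _ m<x = x ∷ S , A , cong (x ∷_) eq , m<x ∷ S>m , A<m
... | tri≈ _ x≡m _ = ⊥-elim (m∉ (here (sym x≡m)))
... | tri< x<m _ _
  with refl ← low∷glue-avoids⇒high≡[] S A x<m S>m (subst Avoids132ˢ (cong (x ∷_) eq) avoids)
  = [] , x ∷ A , cong (x ∷_) eq , [] , x<m ∷ A<m

-- The encoding of forests

encode : ℕ → List PTree → List ℕ
encode o []             = []
encode o (node ds ∷ ts) = glue (encode (suc (o + edgesL ds)) ts) (encode o ds) (suc (o + edgesL ds))

encode-↭ : ∀ o ts → encode o ts ↭ interval o (edgesL ts)
encode-↭ o []             = ↭-refl
encode-↭ o (node ds ∷ ts) =
  ↭-trans (glue-↭⁺ (encode-↭ _ ts) (encode-↭ o ds)) (↭-sym (interval↭glue o (edgesL ds) (edgesL ts)))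

encode-bounded : ∀ o ts → All (λ v → o < v × v ≤ o + edgesL ts) (encode o ts)
encode-bounded o ts = All.tabulate (∈-interval⁻ o _ ∘ Perm.∈-resp-↭ (encode-↭ o ts))

encode-above : ∀ o ts → All (o <_) (encode o ts)
encode-above o ts = All.map proj₁ (encode-bounded o ts)

encode-below : ∀ {x} o ts → o + edgesL ts < x → All (_< x) (encode o ts)
encode-below o ts <x = All.map (λ bounds → ≤-<-trans (proj₂ bounds) <x) (encode-bounded o ts)

encode-separated : ∀ o ds ts →
  Separated (suc (o + edgesL ds)) (encode (suc (o + edgesL ds)) ts) (encode o ds)
encode-separated o ds ts = encode-above _ ts , encode-below o ds ≤-refl

encode-avoids : ∀ o ts → Avoids132ˢ (encode o ts)
encode-avoids o []             ()
encode-avoids o (node ds ∷ ts) =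
  glue-avoids (encode-separated o ds ts) (encode-avoids _ ts) (encode-avoids o ds)

encode-injective : ∀ o ts ts′ → encode o ts ≡ encode o ts′ → ts ≡ ts′
encode-injective o []             []               _  = refl
encode-injective o []             (node ds ∷ ts)   eq = ⊥-elim (glue≢[] (encode _ ts) (encode o ds) _ (sym eq))
encode-injective o (node ds ∷ ts) []               eq = ⊥-elim (glue≢[] (encode _ ts) (encode o ds) _ eq)
encode-injective o (node ds ∷ ts) (node ds′ ∷ ts′) eq
  with m≡m′ , S≡S′ , A≡A′ ← glue-injective (encode-separated o ds ts) (encode-separated o ds′ ts′) eq
  = cong₂ (λ d t → node d ∷ t) (encode-injective o ds ds′ A≡A′)
      (encode-injective _ ts ts′ (trans (cong (λ k → encode k ts) (sym m≡m′)) S≡S′))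

last∉init : ∀ {xs m ys} → xs ++ [ m ] ↭ ys → Unique ys → m ∉ xs
last∉init {xs} {m} p unique =
  Unique[x∷xs]⇒x∉xs (Unique-resp-↭ (↭⇒↭ₛ (↭-sym (↭-trans (Perm.∷↭∷ʳ m xs) p))) unique)

encode-surjective : ∀ o n → Acc _<_ n → ∀ π → π ↭ interval o n → Avoids132ˢ π →
  ∃ λ ts → edgesL ts ≡ n × encode o ts ≡ π
encode-surjective o zero    _         π p _ = [] , refl , sym (Perm.↭-empty-inv p)
encode-surjective o (suc n) (acc rec) π p avoids with initLast π
... | []      = ⊥-elim (0≢1+n (Perm.↭-length p))
... | Q ∷ʳ′ m
  with a , b , refl , refl ← ∈-interval⇒split o (suc n) (Perm.∈-resp-↭ p (∈-++⁺ʳ Q (here refl)))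
  with S , A , π≡glue , sep ← avoids-++-last⇒glue m Q avoids (last∉init p (interval-unique o _))
  with avoids-glue ← subst Avoids132ˢ π≡glue avoids
  with S↭ , A↭ ← glue-↭⁻ sep (interval-separated o a b)
                   (↭-trans (subst (_↭ _) π≡glue p) (interval↭glue o a b))
  with ds , refl , encode≡A ← encode-surjective o a (rec (s≤s (m≤m+n a b))) A A↭
                                 (avoids-⊆ (Sublist.++⁺ˡ S (Sublist.++⁺ʳ [ m ] ⊆-refl)) avoids-glue)
  with ts , refl , encode≡S ← encode-surjective m b (rec (s≤s (m≤n+m b a))) S S↭
                                 (avoids-⊆ (Sublist.++⁺ʳ _ ⊆-refl) avoids-glue)
  = node ds ∷ ts , refl , trans (cong₂ (λ S′ A′ → glue S′ A′ m) encode≡S encode≡A) (sym π≡glue)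

-- Reading the statistics off adjacent entries

𝟙 : Bool → ℕ
𝟙 b = if b then 1 else 0

lastOf : ℕ → List ℕ → ℕ
lastOf x []       = x
lastOf x (y ∷ ys) = lastOf y ys

-- The flag d of ddFrom d (x ∷ ys) and descended d x ys records whether x was reached by a
-- descent; descended d x ys records the same for the last entry of x ∷ ys.
ddFrom : Bool → List ℕ → ℕ
ddFrom d (x ∷ y ∷ ys) = 𝟙 (d ∧ does (y <? x)) + ddFrom (does (y <? x)) (y ∷ ys)
ddFrom _ _            = 0

descended : Bool → ℕ → List ℕ → Bool
descended d x []       = d
descended d x (y ∷ ys) = descended (does (y <? x)) y ys

ascended : Bool → ℕ → List ℕ → Bool
ascended a x []       = a
ascended a x (y ∷ ys) = ascended (does (x <? y)) y ys

doubleDescents≡ddFrom : ∀ x y ys → doubleDescents (x ∷ y ∷ ys) ≡ ddFrom (does (y <? x)) (y ∷ ys)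
doubleDescents≡ddFrom x y []       = refl
doubleDescents≡ddFrom x y (z ∷ ys) =
  cong (𝟙 (does (y <? x) ∧ does (z <? y)) +_) (doubleDescents≡ddFrom y z ys)

doubleDescents-∷ : ∀ x ys → doubleDescents (x ∷ ys) ≡ ddFrom false (x ∷ ys)
doubleDescents-∷ x []       = refl
doubleDescents-∷ x (y ∷ ys) = doubleDescents≡ddFrom x y ys

ascRunsFrom-∷-max : ∀ {x} ys → All (_≤ x) ys → ascRunsFrom false (x ∷ ys) ≡ ascendingRuns ys
ascRunsFrom-∷-max     []       _         = refl
ascRunsFrom-∷-max {x} (y ∷ ys) (y≤x ∷ _) rewrite dec-false (x <? y) (≤⇒≯ y≤x) = refl

lastOf-++ : ∀ x ys zs → lastOf x (ys ++ zs) ≡ lastOf (lastOf x ys) zs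
lastOf-++ x []       zs = refl
lastOf-++ x (y ∷ ys) zs = lastOf-++ y ys zs

lastOf-All : ∀ {P : ℕ → Set} {x} ys → P x → All P ys → P (lastOf x ys)
lastOf-All []       px []         = px
lastOf-All (y ∷ ys) _  (py ∷ pys) = lastOf-All ys py pys

descended-++ : ∀ d x ys zs → descended d x (ys ++ zs) ≡ descended (descended d x ys) (lastOf x ys) zs
descended-++ d x []       zs = refl
descended-++ d x (y ∷ ys) zs = descended-++ _ y ys zs

ascended-++ : ∀ a x ys zs → ascended a x (ys ++ zs) ≡ ascended (ascended a x ys) (lastOf x ys) zs
ascended-++ a x []       zs = refl
ascended-++ a x (y ∷ ys) zs = ascended-++ _ y ys zs

ddFrom-++ : ∀ d x ys zs →
  ddFrom d (x ∷ ys ++ zs) ≡ ddFrom d (x ∷ ys) + ddFrom (descended d x ys) (lastOf x ys ∷ zs)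
ddFrom-++ d x []       zs = refl
ddFrom-++ d x (y ∷ ys) zs =
  trans (cong (𝟙 (d ∧ does (y <? x)) +_) (ddFrom-++ _ y ys zs)) (sym (+-assoc (𝟙 (d ∧ does (y <? x))) _ _))

ascRunsFrom-++ : ∀ a x ys zs →
  ascRunsFrom a (x ∷ ys ++ zs) ≡ ascRunsFrom a (x ∷ ys) + ascRunsFrom (ascended a x ys) (lastOf x ys ∷ zs)
ascRunsFrom-++ a x []       zs = refl
ascRunsFrom-++ a x (y ∷ ys) zs =
  trans (cong (𝟙 (does (x <? y) ∧ not a) +_) (ascRunsFrom-++ _ y ys zs))
        (sym (+-assoc (𝟙 (does (x <? y) ∧ not a)) _ _))

All-glue⁻ : ∀ {P : ℕ → Set} S A m → All P (glue S A m) → All P S × All P A × P m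
All-glue⁻ S A m all-glue
  with all-S , all-Am ← All.++⁻ S all-glue
  with all-A , pm ∷ [] ← All.++⁻ A all-Am = all-S , all-A , pm

lastOf-glue : ∀ x S A m → lastOf x (glue S A m) ≡ m
lastOf-glue x S A m = trans (lastOf-++ x S (A ++ [ m ])) (lastOf-++ (lastOf x S) A [ m ])

descended-glue : ∀ d x S A m → descended d x (glue S A m) ≡ does (m <? lastOf (lastOf x S) A)
descended-glue d x S A m = trans (descended-++ d x S (A ++ [ m ])) (descended-++ _ (lastOf x S) A [ m ])

ascended-glue : ∀ a x S A m → ascended a x (glue S A m) ≡ does (lastOf (lastOf x S) A <? m)
ascended-glue a x S A m = trans (ascended-++ a x S (A ++ [ m ])) (ascended-++ _ (lastOf x S) A [ m ])

isLeaf-node : ∀ ds → isLeaf (node ds) ≡ 𝟙 (null ds)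
isLeaf-node []      = refl
isLeaf-node (_ ∷ _) = refl

lastOf-encode<root : ∀ y o es ds → lastOf y (encode o (node es ∷ ds)) < suc (o + edgesL (node es ∷ ds))
lastOf-encode<root y o es ds =
  subst (_< suc (o + edgesL (node es ∷ ds))) (sym (lastOf-glue y (encode _ ds) (encode o es) _))
        (s≤s (+-monoʳ-< o (s≤s (m≤m+n (edgesL es) (edgesL ds)))))

root<lastOf-high : ∀ {x} o ds ts → All (_< x) (encode o (node ds ∷ ts)) →
  suc (o + edgesL ds) < lastOf x (encode (suc (o + edgesL ds)) ts)
root<lastOf-high o ds ts all<x =
  lastOf-All (encode _ ts) (proj₂ (proj₂ (All-glue⁻ (encode _ ts) (encode o ds) _ all<x))) (encode-above _ ts)

descended-encode : ∀ {x} d o ds ts → All (_< x) (encode o (node ds ∷ ts)) →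
  descended d x (encode o (node ds ∷ ts)) ≡ null ds
descended-encode {x} d o []             ts all<x =
  trans (descended-glue d x (encode _ ts) [] _) (dec-true (_ <? _) (root<lastOf-high o [] ts all<x))
descended-encode {x} d o (node es ∷ ds) ts all<x =
  trans (descended-glue d x (encode _ ts) (encode o (node es ∷ ds)) _)
        (dec-false (_ <? _) (<⇒≯ (lastOf-encode<root _ o es ds)))

ascended-encode : ∀ {x} a o ds ts → All (_< x) (encode o (node ds ∷ ts)) →
  ascended a x (encode o (node ds ∷ ts)) ≡ not (null ds)
ascended-encode {x} a o []             ts all<x =
  trans (ascended-glue a x (encode _ ts) [] _) (dec-false (_ <? _) (<⇒≯ (root<lastOf-high o [] ts all<x)))
ascended-encode {x} a o (node es ∷ ds) ts all<x =
  trans (ascended-glue a x (encode _ ts) (encode o (node es ∷ ds)) _)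
        (dec-true (_ <? _) (lastOf-encode<root _ o es ds))

youngLeaves-descended : ∀ {x} d o ts → All (_< x) (encode o ts) →
  youngLeaves (node ts) + 𝟙 (d ∧ not (null ts)) + 𝟙 (descended d x (encode o ts)) ≡ youngLeavesL ts + 𝟙 d
youngLeaves-descended d o []             _ rewrite ∧-zeroʳ d = refl
youngLeaves-descended d o (node es ∷ ts) all<x
  rewrite descended-encode d o es ts all<x | ∧-identityʳ d | isLeaf-node es =
  solve 4 (λ e t b l → (e :+ t) :+ b :+ l := (l :+ e :+ t) :+ b) refl
    (youngLeaves (node es)) (youngLeavesL ts) (𝟙 d) (𝟙 (null es))

mutual
  ddFrom-encode : ∀ {x} d o ts → All (_< x) (encode o ts) →
    ddFrom d (x ∷ encode o ts) ≡ youngLeaves (node ts) + 𝟙 (d ∧ not (null ts))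
  ddFrom-encode d o [] _ = cong 𝟙 (sym (∧-zeroʳ d))
  ddFrom-encode {x} d o (node ds ∷ ts) all<x = begin
    ddFrom d (x ∷ S ++ A ++ [ m ])
      ≡⟨ ddFrom-++ d x S (A ++ [ m ]) ⟩
    ddFrom d (x ∷ S) + ddFrom d′ (lastOf x S ∷ A ++ [ m ])
      ≡⟨ cong₂ _+_ (ddFrom-encode d m ts all-S)
                   (ddFrom-encode-++-root d′ o ds (root<lastOf-high o ds ts all<x)) ⟩
    (youngLeaves (node ts) + 𝟙 (d ∧ not (null ts))) + (youngLeaves (node ds) + 𝟙 d′)
      ≡⟨ solve 4 (λ t b a e → (t :+ b) :+ (a :+ e) := a :+ (t :+ b :+ e)) refl
           (youngLeaves (node ts)) (𝟙 (d ∧ not (null ts))) (youngLeaves (node ds)) (𝟙 d′) ⟩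
    youngLeaves (node ds) + (youngLeaves (node ts) + 𝟙 (d ∧ not (null ts)) + 𝟙 d′)
      ≡⟨ cong (youngLeaves (node ds) +_) (youngLeaves-descended d m ts all-S) ⟩
    youngLeaves (node ds) + (youngLeavesL ts + 𝟙 d)
      ≡⟨ sym (+-assoc (youngLeaves (node ds)) _ _) ⟩
    youngLeaves (node ds) + youngLeavesL ts + 𝟙 d
      ≡⟨ cong (λ b → youngLeaves (node ds) + youngLeavesL ts + 𝟙 b) (sym (∧-identityʳ d)) ⟩
    youngLeaves (node ds) + youngLeavesL ts + 𝟙 (d ∧ true)
      ∎
    where
    open ≡-Reasoning
    m : ℕ
    m = suc (o + edgesL ds)
    S A : List ℕ
    S = encode m ts
    A = encode o ds
    d′ : Bool
    d′ = descended d x S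
    all-S : All (_< x) S
    all-S = proj₁ (All-glue⁻ S A m all<x)

  ddFrom-encode-++-root : ∀ {y} d o ds → suc (o + edgesL ds) < y →
    ddFrom d (y ∷ encode o ds ++ [ suc (o + edgesL ds) ]) ≡ youngLeaves (node ds) + 𝟙 d
  ddFrom-encode-++-root {y} d o []             m<y
    rewrite dec-true (suc (o + 0) <? y) m<y | ∧-identityʳ d = +-identityʳ (𝟙 d)
  ddFrom-encode-++-root {y} d o (node es ∷ ds) m<y = begin
    ddFrom d (y ∷ A ++ [ m ])
      ≡⟨ ddFrom-++ d y A [ m ] ⟩
    ddFrom d (y ∷ A) + (𝟙 (d′ ∧ does (m <? lastOf y A)) + 0)
      ≡⟨ cong₂ _+_ (ddFrom-encode d o (node es ∷ ds) all-A)
                   (cong (λ b → 𝟙 (d′ ∧ b) + 0) no-descent) ⟩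
    youngLeaves (node (node es ∷ ds)) + 𝟙 (d ∧ true) + (𝟙 (d′ ∧ false) + 0)
      ≡⟨ cong₂ (λ b b′ → youngLeaves (node (node es ∷ ds)) + 𝟙 b + (𝟙 b′ + 0))
               (∧-identityʳ d) (∧-zeroʳ d′) ⟩
    youngLeaves (node (node es ∷ ds)) + 𝟙 d + 0
      ≡⟨ +-identityʳ _ ⟩
    youngLeaves (node (node es ∷ ds)) + 𝟙 d
      ∎
    where
    open ≡-Reasoning
    m : ℕ
    m = suc (o + edgesL (node es ∷ ds))
    A : List ℕ
    A = encode o (node es ∷ ds)
    d′ : Bool
    d′ = descended d y A
    all-A : All (_< y) A
    all-A = All.map (λ v<m → <-trans v<m m<y) (encode-below o (node es ∷ ds) ≤-refl)
    no-descent : does (m <? lastOf y A) ≡ false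
    no-descent = dec-false (m <? _) (<⇒≯ (lastOf-encode<root y o es ds))

mutual
  ascRunsFrom-encode : ∀ {x} a o ts → All (_< x) (encode o ts) →
    ascRunsFrom a (x ∷ encode o ts) ≡ oldLeavesL ts
  ascRunsFrom-encode a o [] _ = refl
  ascRunsFrom-encode {x} a o (node ds ∷ ts) all<x = begin
    ascRunsFrom a (x ∷ S ++ A ++ [ m ])
      ≡⟨ ascRunsFrom-++ a x S (A ++ [ m ]) ⟩
    ascRunsFrom a (x ∷ S) + ascRunsFrom (ascended a x S) (lastOf x S ∷ A ++ [ m ])
      ≡⟨ cong₂ _+_ (ascRunsFrom-encode a m ts all-S)
                   (ascRunsFrom-encode-++-root _ o ds (<⇒≤ (root<lastOf-high o ds ts all<x))) ⟩
    oldLeavesL ts + oldLeaves (node ds)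
      ≡⟨ +-comm (oldLeavesL ts) _ ⟩
    oldLeaves (node ds) + oldLeavesL ts
      ∎
    where
    open ≡-Reasoning
    m : ℕ
    m = suc (o + edgesL ds)
    S A : List ℕ
    S = encode m ts
    A = encode o ds
    all-S : All (_< x) S
    all-S = proj₁ (All-glue⁻ S A m all<x)

  ascRunsFrom-encode-++-root : ∀ {y} a o ds → suc (o + edgesL ds) ≤ y →
    ascRunsFrom a (y ∷ encode o ds ++ [ suc (o + edgesL ds) ]) ≡ oldLeaves (node ds)
  ascRunsFrom-encode-++-root {y} a o []             m≤y
    rewrite dec-false (y <? suc (o + 0)) (≤⇒≯ m≤y) = refl
  ascRunsFrom-encode-++-root {y} a o (node es ∷ ds) m≤y = begin
    ascRunsFrom a (y ∷ A ++ [ m ])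
      ≡⟨ ascRunsFrom-++ a y A [ m ] ⟩
    ascRunsFrom a (y ∷ A) + (𝟙 (does (lastOf y A <? m) ∧ not (ascended a y A)) + 0)
      ≡⟨ cong₂ (λ r b → r + (𝟙 b + 0)) (ascRunsFrom-encode a o (node es ∷ ds) all-A) run-starts ⟩
    oldLeaves (node es) + oldLeavesL ds + (𝟙 (null es) + 0)
      ≡⟨ solve 3 (λ e r l → e :+ r :+ (l :+ con 0) := l :+ e :+ r) refl
           (oldLeaves (node es)) (oldLeavesL ds) (𝟙 (null es)) ⟩
    𝟙 (null es) + oldLeaves (node es) + oldLeavesL ds
      ≡⟨ cong (λ l → l + oldLeaves (node es) + oldLeavesL ds) (sym (isLeaf-node es)) ⟩
    oldLeaves (node (node es ∷ ds))
      ∎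
    where
    open ≡-Reasoning
    m : ℕ
    m = suc (o + edgesL (node es ∷ ds))
    A : List ℕ
    A = encode o (node es ∷ ds)
    all-A : All (_< y) A
    all-A = All.map (λ v<m → <-≤-trans v<m m≤y) (encode-below o (node es ∷ ds) ≤-refl)
    run-starts : does (lastOf y A <? m) ∧ not (ascended a y A) ≡ null es
    run-starts rewrite dec-true (lastOf y A <? m) (lastOf-encode<root y o es ds)
                     | ascended-encode a o es ds all-A = not-involutive (null es)

youngLeaves≡doubleDescents : ∀ {n} ts → edgesL ts ≡ n →
  youngLeaves (node ts) ≡ doubleDescents (suc n ∷ encode 0 ts)
youngLeaves≡doubleDescents ts refl = begin
  youngLeaves (node ts)                            ≡⟨ +-identityʳ _ ⟨
  youngLeaves (node ts) + 0                        ≡⟨ ddFrom-encode false 0 ts (encode-below 0 ts ≤-refl) ⟨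
  ddFrom false (suc (edgesL ts) ∷ encode 0 ts)     ≡⟨ doubleDescents-∷ _ (encode 0 ts) ⟨
  doubleDescents (suc (edgesL ts) ∷ encode 0 ts)   ∎
  where open ≡-Reasoning

oldLeaves≡ascendingRuns : ∀ {n} ts → edgesL ts ≡ n →
  oldLeaves (node ts) ≡ ascendingRuns (encode 0 ts ++ [ suc n ])
oldLeaves≡ascendingRuns ts refl = begin
  oldLeaves (node ts)                               ≡⟨ ascRunsFrom-encode-++-root false 0 ts ≤-refl ⟨
  ascRunsFrom false (N ∷ encode 0 ts ++ [ N ])      ≡⟨ ascRunsFrom-∷-max (encode 0 ts ++ [ N ]) all≤N ⟩
  ascendingRuns (encode 0 ts ++ [ N ])              ∎
  where
  open ≡-Reasoning
  N : ℕ
  N = suc (edgesL ts)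
  all≤N : All (_≤ N) (encode 0 ts ++ [ N ])
  all≤N = All.++⁺ (All.map <⇒≤ (encode-below 0 ts ≤-refl)) (≤-refl ∷ [])

Trees : ℕ → Set
Trees n = Σ PTree (λ t → edges t ≡ n)

φ : ∀ {n} → Trees n → List ℕ
φ (node ts , _) = encode 0 ts

φ-↭ : ∀ {n} (T : Trees n) → φ T ↭ oneTo n
φ-↭ (node ts , refl) = subst (encode 0 ts ↭_) (sym (oneTo≡interval _)) (encode-↭ 0 ts)

φ-avoids : ∀ {n} (T : Trees n) → Avoids132 (φ T)
φ-avoids (node ts , _) = Avoids132ˢ⇒Avoids132 _ (encode-avoids 0 ts)

φ-injective : ∀ {n} (T T′ : Trees n) → φ T ≡ φ T′ → proj₁ T ≡ proj₁ T′
φ-injective (node ts , _) (node ts′ , _) eq = cong node (encode-injective 0 ts ts′ eq)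

φ-surjective : ∀ n π → π ↭ oneTo n → Avoids132 π → ∃ λ (T : Trees n) → φ T ≡ π
φ-surjective n π π↭ avoids
  with ts , edges≡n , encode≡π ← encode-surjective 0 n (<-wellFounded n) π
         (subst (π ↭_) (oneTo≡interval n) π↭) (Avoids132⇒Avoids132ˢ π avoids)
  = (node ts , edges≡n) , encode≡π

φ-youngLeaves : ∀ {n} (T : Trees n) → youngLeaves (proj₁ T) ≡ doubleDescents (suc n ∷ φ T)
φ-youngLeaves (node ts , edges≡n) = youngLeaves≡doubleDescents ts edges≡n

φ-oldLeaves : ∀ {n} (T : Trees n) → oldLeaves (proj₁ T) ≡ ascendingRuns (φ T ++ (suc n ∷ []))
φ-oldLeaves (node ts , edges≡n) = oldLeaves≡ascendingRuns ts edges≡n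

mainTheorem6 : (n : ℕ) → n ≥ 1 →
    Σ (Σ PTree (λ t → edges t ≡ n) → List ℕ) λ φ →
      -- φ maps into S_n(132)
      ((T : Σ PTree (λ t → edges t ≡ n)) → (φ T ↭ oneTo n) × Avoids132 (φ T))
      -- injective
      × ((T T′ : Σ PTree (λ t → edges t ≡ n)) → φ T ≡ φ T′ → proj₁ T ≡ proj₁ T′)
      -- surjective onto S_n(132)
      × ((π : List ℕ) → π ↭ oneTo n → Avoids132 π → ∃ λ T → φ T ≡ π)
      -- (1) young leaves = double descents of (n+1)π
      × ((T : Σ PTree (λ t → edges t ≡ n)) →
           youngLeaves (proj₁ T) ≡ doubleDescents (suc n ∷ φ T))
      -- (2) old leaves = ascending runs of π(n+1)
      × ((T : Σ PTree (λ t → edges t ≡ n)) →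
           oldLeaves (proj₁ T) ≡ ascendingRuns (φ T ++ (suc n ∷ [])))
mainTheorem6 n _ =
  φ , (λ T → φ-↭ T , φ-avoids T) , φ-injective , φ-surjective n , φ-youngLeaves , φ-oldLeaves
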